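{- The TRS $\mathcal{H}_{\mathrm{lab}}\cup\mathcal{D}\mathrm{ec}$ is AC terminating.
   Context: Let $\mathbb{O}$ be the set of ordinals below $\varepsilon_0$. The signature consists of constants $\mathsf{h},\mathsf{0}$; unary $\mathsf{I},\mathsf{E},\mathsf{s}$; binary $\mathsf{C},\mathsf{D}$; binary $\mathsf{A}_v,\mathsf{B}_v$ for each $v\in\mathbb{O}$; and the binary symbol $\mid$ (infix), the only AC symbol. The TRS $\mathcal{H}_{\mathrm{lab}}$ consists of, for all $v\in\mathbb{O}$: (1) $\mathsf{A}_\omega(n,\mathsf{I}(\mathsf{h}))\to\mathsf{A}_1(\mathsf{s}(n),\mathsf{h})$; (2) $\mathsf{A}_{\omega^{v+1}}(n,\mathsf{I}(\mathsf{h}\mid x))\to\mathsf{A}_{\omega^v}(\mathsf{s}(n),\mathsf{I}(x))$; (3) $\mathsf{A}_{\omega^v}(n,\mathsf{I}(x))\to\mathsf{B}_{\omega^v}(n,\mathsf{D}(\mathsf{s}(n),\mathsf{I}(x)))$; (4) $\mathsf{C}(\mathsf{0},x)\to\mathsf{E}(x)$; (5) $\mathsf{C}(\mathsf{s}(n),x)\to x\mid\mathsf{C}(n,x)$; (6) $\mathsf{I}(\mathsf{E}(x)\mid y)\to\mathsf{E}(\mathsf{I}(x\mid y))$; (7) $\mathsf{I}(\mathsf{E}(x))\to\mathsf{E}(\mathsf{I}(x))$; (8) $\mathsf{D}(n,\mathsf{I}(\mathsf{I}(x)))\to\mathsf{I}(\mathsf{D}(n,\mathsf{I}(x)))$; (9)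 $\mathsf{D}(n,\mathsf{I}(\mathsf{I}(x)\mid y))\to\mathsf{I}(\mathsf{D}(n,\mathsf{I}(x))\mid y)$; (10) $\mathsf{D}(n,\mathsf{I}(\mathsf{I}(\mathsf{h}\mid x)\mid y))\to\mathsf{I}(\mathsf{C}(n,\mathsf{I}(x))\mid y)$; (11) $\mathsf{D}(n,\mathsf{I}(\mathsf{I}(\mathsf{h}\mid x)))\to\mathsf{I}(\mathsf{C}(n,\mathsf{I}(x)))$; (12) $\mathsf{D}(n,\mathsf{I}(\mathsf{I}(\mathsf{h})\mid y))\to\mathsf{I}(\mathsf{C}(n,\mathsf{h})\mid y)$; (13) $\mathsf{D}(n,\mathsf{I}(\mathsf{I}(\mathsf{h})))\to\mathsf{I}(\mathsf{C}(n,\mathsf{h}))$; (14) $\mathsf{B}_{v+1}(n,\mathsf{E}(x))\to\mathsf{A}_v(\mathsf{s}(n),x)$. $\mathcal{D}\mathrm{ec}$ consists of $\mathsf{A}_v(n,x)\to\mathsf{A}_w(n,x)$ and $\mathsf{B}_v(n,x)\to\mathsf{B}_w(n,x)$ for all $v,w\in\mathbb{O}$ with $v>w$. $=_{\mathrm{AC}}$ is the congruence generated by associativity and commutativity of $\mid$; for a TRS $\mathcal{R}$, $\to_{\mathcal{R}/\mathrm{AC}}={=_{\mathrm{AC}}}\cdot{\to_{\mathcal{R}}}\cdot{=_{\mathrm{AC}}}$ with $\to_{\mathcal{R}}$ the closure of $\mathcal{R}$ under substitutions and contexts, and $\mathcal{R}$ is AC terminating if $\to_{\mathcal{R}/\mathrm{AC}}$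 is well-founded. -}

module Defs where

open import Data.Nat using (ℕ)
open import Data.Sum using (_⊎_; inj₁; inj₂)
open import Relation.Binary.PropositionalEquality using (_≡_; refl)
open import Relation.Binary.Construct.Closure.Equivalence using (EqClosure)
open import Induction.WellFounded using (WellFounded)

-- Ordinals below ε₀ in Cantor normal form.
-- ω^ a + b  denotes  ω^a + b.

data CNF : Set where
  𝟎    : CNF
  ω^_+_ : CNF → CNF → CNF

infix 4 _<ᶜ_ _≤ᶜ_

data _<ᶜ_ : CNF → CNF → Set where
  <-zero : ∀ {a b} → 𝟎 <ᶜ ω^ a + b
  <-exp  : ∀ {a b c d} → a <ᶜ c → ω^ a + b <ᶜ ω^ c + d
  <-tail : ∀ {a b d} → b <ᶜ d → ω^ a + b <ᶜ ω^ a + d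

_≤ᶜ_ : CNF → CNF → Set
a ≤ᶜ b = a <ᶜ b ⊎ a ≡ b

data Lead (a : CNF) : CNF → Set where
  lead0 : Lead a 𝟎
  leadω : ∀ {c d} → c ≤ᶜ a → Lead a (ω^ c + d)

data NF : CNF → Set where
  nf0 : NF 𝟎
  nfω : ∀ {a b} → NF a → NF b → Lead a b → NF (ω^ a + b)

record 𝕆 : Set where
  constructor ⟨_,_⟩
  field
    tm  : CNF
    .nf : NF tm
open 𝕆 public

infix 4 _<ₒ_ _>ₒ_
_<ₒ_ : 𝕆 → 𝕆 → Set
v <ₒ w = tm v <ᶜ tm w

_>ₒ_ : 𝕆 → 𝕆 → Set
v >ₒ w = w <ₒ v

sucᶜ : CNF → CNF
sucᶜ 𝟎 = ω^ 𝟎 + 𝟎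
sucᶜ (ω^ a + b) = ω^ a + sucᶜ b

private
  0≤ : ∀ a → 𝟎 ≤ᶜ a
  0≤ 𝟎 = inj₂ refl
  0≤ (ω^ a + b) = inj₁ <-zero

  lead-suc : ∀ {a b} → Lead a b → Lead a (sucᶜ b)
  lead-suc {a} lead0 = leadω (0≤ a)
  lead-suc (leadω p) = leadω p

  nf-suc : ∀ {a} → NF a → NF (sucᶜ a)
  nf-suc nf0 = nfω nf0 nf0 lead0
  nf-suc (nfω p q l) = nfω p (nf-suc q) (lead-suc l)

_+1 : 𝕆 → 𝕆
⟨ t , p ⟩ +1 = ⟨ sucᶜ t , nf-suc p ⟩

ωpow : 𝕆 → 𝕆
ωpow ⟨ t , p ⟩ = ⟨ ω^ t + 𝟎 , nfω p nf0 lead0 ⟩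

oone : 𝕆
oone = ⟨ ω^ 𝟎 + 𝟎 , nfω nf0 nf0 lead0 ⟩

ω : 𝕆
ω = ωpow oone

infixr 5 _∣_

data Term : Set where
  var  : ℕ → Term
  h 𝟘  : Term
  I E s : Term → Term
  C D  : Term → Term → Term
  A B  : 𝕆 → Term → Term → Term
  _∣_  : Term → Term → Term

data Ctx : Set where
  □    : Ctx
  I□ E□ s□ : Ctx → Ctx
  C₁ D₁ : Ctx → Term → Ctx
  C₂ D₂ : Term → Ctx → Ctx
  A₁ B₁ : 𝕆 → Ctx → Term → Ctx
  A₂ B₂ : 𝕆 → Term → Ctx → Ctx
  ∣₁   : Ctx → Term → Ctx
  ∣₂   : Term → Ctx → Ctx

_[_] : Ctx → Term → Term
□ [ t ] = t
I□ c [ t ] = I (c [ t ])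
E□ c [ t ] = E (c [ t ])
s□ c [ t ] = s (c [ t ])
C₁ c u [ t ] = C (c [ t ]) u
D₁ c u [ t ] = D (c [ t ]) u
C₂ u c [ t ] = C u (c [ t ])
D₂ u c [ t ] = D u (c [ t ])
A₁ v c u [ t ] = A v (c [ t ]) u
B₁ v c u [ t ] = B v (c [ t ]) u
A₂ v u c [ t ] = A v u (c [ t ])
B₂ v u c [ t ] = B v u (c [ t ])
∣₁ c u [ t ] = (c [ t ]) ∣ u
∣₂ u c [ t ] = u ∣ (c [ t ])

-- closure of a relation under contexts (a root-step relation whose
-- rule variables range over all terms is already closed under substitutions)
data CtxClosure (R : Term → Term → Set) : Term → Term → Set where
  ctx : ∀ c {l r} → R l r → CtxClosure R (c [ l ]) (c [ r ])

data ACAxiom : Term → Term → Set where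
  assoc : ∀ x y z → ACAxiom ((x ∣ y) ∣ z) (x ∣ (y ∣ z))
  comm  : ∀ x y → ACAxiom (x ∣ y) (y ∣ x)

_=AC_ : Term → Term → Set
_=AC_ = EqClosure (CtxClosure ACAxiom)

-- The rules of H_lab (instances of the rules: all substitutions)

data Hlab : Term → Term → Set where
  r1  : ∀ n → Hlab (A ω n (I h)) (A oone (s n) h)
  r2  : ∀ v n x → Hlab (A (ωpow (v +1)) n (I (h ∣ x))) (A (ωpow v) (s n) (I x))
  r3  : ∀ v n x → Hlab (A (ωpow v) n (I x)) (B (ωpow v) n (D (s n) (I x)))
  r4  : ∀ x → Hlab (C 𝟘 x) (E x)
  r5  : ∀ n x → Hlab (C (s n) x) (x ∣ C n x)
  r6  : ∀ x y → Hlab (I (E x ∣ y)) (E (I (x ∣ y)))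
  r7  : ∀ x → Hlab (I (E x)) (E (I x))
  r8  : ∀ n x → Hlab (D n (I (I x))) (I (D n (I x)))
  r9  : ∀ n x y → Hlab (D n (I (I x ∣ y))) (I (D n (I x) ∣ y))
  r10 : ∀ n x y → Hlab (D n (I (I (h ∣ x) ∣ y))) (I (C n (I x) ∣ y))
  r11 : ∀ n x → Hlab (D n (I (I (h ∣ x)))) (I (C n (I x)))
  r12 : ∀ n y → Hlab (D n (I (I h ∣ y))) (I (C n h ∣ y))
  r13 : ∀ n → Hlab (D n (I (I h))) (I (C n h))
  r14 : ∀ v n x → Hlab (B (v +1) n (E x)) (A v (s n) x)

data Dec : Term → Term → Set where
  decA : ∀ v w n x → v >ₒ w → Dec (A v n x) (A w n x)
  decB : ∀ v w n x → v >ₒ w → Dec (B v n x) (B w n x)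

_∪_ : (Term → Term → Set) → (Term → Term → Set) → Term → Term → Set
(R ∪ S) l r = R l r ⊎ S l r

data _⟶[_/AC]_ (t : Term) (R : Term → Term → Set) (u : Term) : Set where
  step : ∀ {t' u'} → t =AC t' → CtxClosure R t' u' → u' =AC u → t ⟶[ R /AC] u

ACTerminating : (Term → Term → Set) → Set
ACTerminating R = WellFounded (λ u t → t ⟶[ R /AC] u)

{-# OPTIONS --safe #-}
-- The maximal A- and B-rooted subterms of a term are its aliens. The polynomial
-- interpretation ⟦_⟧, reading ∣ as + and giving every alien weight 1, is invariant
-- under AC; rules 4-13 strictly decrease it and create no new aliens, while a step
-- at or inside an alien keeps the weight and replaces that alien by a reduct. So a
-- term terminates once its aliens do, by induction on the weight and then on the
-- multiset of aliens. An alien A_v(n,x) or B_v(n,x) with terminating arguments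
-- terminates by induction on v: its AC-equivalents are the same symbol applied to
-- AC-equivalent arguments, and every root step lowers the label, except rule 3,
-- which keeps it but turns A into B, whose only root steps do lower it.

module Submission where

open import Defs
open import Level using (_⊔_; 0ℓ)
open import Data.Nat using (ℕ; suc; _+_; _*_; _<_; s≤s; z<s)
open import Data.Nat.Properties using (+-assoc; +-comm; m<m+n; +-monoˡ-<; +-monoʳ-<; *-monoˡ-<; *-monoʳ-<)
open import Data.Nat.Induction using (<-wellFounded)
open import Data.Nat.Tactic.RingSolver using (solve-∀)
open import Data.List using (List; []; _∷_; _++_)
open import Data.List.Relation.Unary.All using (All; []; _∷_)
import Data.List.Relation.Unary.All.Properties as All
import Data.List.Relation.Unary.Any.Properties as Any
open import Data.List.Relation.Binary.Pointwise using (_∷_)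
import Data.List.Relation.Binary.Permutation.Setoid as Permutation
import Data.List.Relation.Binary.Permutation.Setoid.Properties as Permutationₚ
import Data.List.Relation.Binary.Subset.Setoid as Subset
import Data.List.Relation.Binary.Subset.Setoid.Properties as ⊆
open import Data.Product using (∃; ∃₂; _×_; _,_)
open import Data.Sum using (_⊎_; inj₁; inj₂; [_,_]′)
open import Data.Empty using (⊥-elim)
open import Function using (id; flip)
open import Relation.Nullary using (¬_; yes; no) renaming (Dec to Decidable)
open import Relation.Nullary.Decidable using (map′; _×-dec_; _⊎-dec_; recompute)
open import Relation.Binary using (Rel; Setoid; _Respectsˡ_; _Respects_)
open import Relation.Binary.Definitions using (DecidableEquality)
open import Relation.Binary.PropositionalEquality using (_≡_; refl; cong; sym; trans; subst; isEquivalence)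
open import Relation.Binary.Construct.Closure.ReflexiveTransitive using (ε; _◅_; _◅◅_)
open import Relation.Binary.Construct.Closure.Symmetric using (SymClosure; fwd; bwd)
import Relation.Binary.Construct.Closure.Equivalence as EqClosure
open import Induction.WellFounded using (WellFounded; Acc; acc; module Subrelation)

-- Ordinals below ε₀

<ᶜ-trans : ∀ {a b c} → a <ᶜ b → b <ᶜ c → a <ᶜ c
<ᶜ-trans <-zero     (<-exp _)  = <-zero
<ᶜ-trans <-zero     (<-tail _) = <-zero
<ᶜ-trans (<-exp p)  (<-exp q)  = <-exp (<ᶜ-trans p q)
<ᶜ-trans (<-exp p)  (<-tail _) = <-exp p
<ᶜ-trans (<-tail _) (<-exp q)  = <-exp q
<ᶜ-trans (<-tail p) (<-tail q) = <-tail (<ᶜ-trans p q)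

≤<ᶜ-trans : ∀ {a b c} → a ≤ᶜ b → b <ᶜ c → a <ᶜ c
≤<ᶜ-trans (inj₁ a<b)  b<c = <ᶜ-trans a<b b<c
≤<ᶜ-trans (inj₂ refl) b<c = b<c

<ᶜ-sucᶜ : ∀ a → a <ᶜ sucᶜ a
<ᶜ-sucᶜ 𝟎          = <-zero
<ᶜ-sucᶜ (ω^ a + b) = <-tail (<ᶜ-sucᶜ b)

Lead⇒< : ∀ {a b c d} → Lead c d → c <ᶜ a → d <ᶜ ω^ a + b
Lead⇒< lead0       _   = <-zero
Lead⇒< (leadω e≤c) c<a = <-exp (≤<ᶜ-trans e≤c c<a)

_≟ᶜ_ : DecidableEquality CNF
𝟎 ≟ᶜ 𝟎 = yes refl
𝟎 ≟ᶜ (ω^ _ + _) = no λ ()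
(ω^ _ + _) ≟ᶜ 𝟎 = no λ ()
(ω^ a + b) ≟ᶜ (ω^ c + d) =
  map′ (λ { (refl , refl) → refl }) (λ { refl → refl , refl }) (a ≟ᶜ c ×-dec b ≟ᶜ d)

_<ᶜ?_ : ∀ a b → Decidable (a <ᶜ b)
_ <ᶜ? 𝟎 = no λ ()
𝟎 <ᶜ? (ω^ _ + _) = yes <-zero
(ω^ a + b) <ᶜ? (ω^ c + d) = map′ from to (a <ᶜ? c ⊎-dec (a ≟ᶜ c ×-dec b <ᶜ? d))
  where
  from : a <ᶜ c ⊎ (a ≡ c × b <ᶜ d) → ω^ a + b <ᶜ ω^ c + d
  from (inj₁ a<c)          = <-exp a<c
  from (inj₂ (refl , b<d)) = <-tail b<d
  to : ω^ a + b <ᶜ ω^ c + d → a <ᶜ c ⊎ (a ≡ c × b <ᶜ d)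
  to (<-exp a<c)  = inj₁ a<c
  to (<-tail b<d) = inj₂ (refl , b<d)

Lead? : ∀ a b → Decidable (Lead a b)
Lead? a 𝟎          = yes lead0
Lead? a (ω^ c + _) = map′ leadω (λ { (leadω c≤a) → c≤a }) (c <ᶜ? a ⊎-dec c ≟ᶜ a)

-- 𝕆 stores its normal-form proof irrelevantly; deciding NF recovers a usable one.
NF? : ∀ a → Decidable (NF a)
NF? 𝟎          = yes nf0
NF? (ω^ a + b) = map′ (λ (pa , pb , l) → nfω pa pb l) (λ { (nfω pa pb l) → pa , pb , l })
                      (NF? a ×-dec NF? b ×-dec Lead? a b)

acc-𝟎 : Acc _<ₒ_ ⟨ 𝟎 , nf0 ⟩
acc-𝟎 = acc λ ()

mutual
  acc-ω^+ : ∀ {a b} (pa : NF a) (pb : NF b) (l : Lead a b) →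
            Acc _<ₒ_ ⟨ a , pa ⟩ → Acc _<ₒ_ ⟨ b , pb ⟩ → Acc _<ₒ_ ⟨ ω^ a + b , nfω pa pb l ⟩
  acc-ω^+ _ _ _ acc-a acc-b = acc λ { {⟨ c , pc ⟩} c< → acc-below acc-a acc-b (recompute (NF? c) pc) c< }

  acc-below : ∀ {a b c} .{pa : NF a} .{pb : NF b} → Acc _<ₒ_ ⟨ a , pa ⟩ → Acc _<ₒ_ ⟨ b , pb ⟩ →
              (pc : NF c) → c <ᶜ ω^ a + b → Acc _<ₒ_ ⟨ c , pc ⟩
  acc-below _ _ nf0 <-zero = acc-𝟎
  acc-below acc-a@(acc below-a) acc-b (nfω pe pf l) (<-exp e<a) =
    acc-ω^+ pe pf l (below-a e<a) (acc-below acc-a acc-b pf (Lead⇒< l e<a))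
  acc-below acc-a (acc below-b) (nfω pe pf l) (<-tail f<b) =
    acc-ω^+ pe pf l acc-a (below-b f<b)

acc-NF : ∀ {a} (pa : NF a) → Acc _<ₒ_ ⟨ a , pa ⟩
acc-NF nf0           = acc-𝟎
acc-NF (nfω pa pb l) = acc-ω^+ pa pb l (acc-NF pa) (acc-NF pb)

<ₒ-wellFounded : WellFounded _<ₒ_
<ₒ-wellFounded ⟨ a , pa ⟩ = acc-NF (recompute (NF? a) pa)

-- Replacing one element of a list, modulo permutation

module ListReplacement {a ℓ r} (S : Setoid a ℓ) (_⇝_ : Rel (Setoid.Carrier S) r)
                       (⇝-respˡ : _⇝_ Respectsˡ Setoid._≈_ S) where

  open Setoid S using (_≈_) renaming (Carrier to X; sym to ≈-sym)
  open Permutation S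
  open Permutationₚ S

  Terminating : X → Set _
  Terminating = Acc (flip _⇝_)

  Terminating-resp-≈ : Terminating Respects _≈_
  Terminating-resp-≈ x≈y (acc rs) = acc λ y⇝z → rs (⇝-respˡ (≈-sym x≈y) y⇝z)

  infix 4 _⇝₁_

  _⇝₁_ : Rel (List X) (a ⊔ ℓ ⊔ r)
  xs ⇝₁ ys = ∃₂ λ x y → ∃ λ zs → xs ↭ x ∷ zs × ys ↭ y ∷ zs × x ⇝ y

  ⇝₁-singleton : ∀ {x y} → x ⇝ y → x ∷ [] ⇝₁ y ∷ []
  ⇝₁-singleton x⇝y = _ , _ , [] , ↭-refl , ↭-refl , x⇝y

  ⇝₁-resp-↭ : ∀ {xs xs′ ys ys′} → xs ↭ xs′ → xs′ ⇝₁ ys′ → ys′ ↭ ys → xs ⇝₁ ys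
  ⇝₁-resp-↭ xs↭ (x , y , zs , p , q , x⇝y) ys↭ = x , y , zs , ↭-trans xs↭ p , ↭-trans (↭-sym ys↭) q , x⇝y

  ⇝₁-++ˡ : ∀ ws {xs ys} → xs ⇝₁ ys → ws ++ xs ⇝₁ ws ++ ys
  ⇝₁-++ˡ ws (x , y , zs , p , q , x⇝y) =
    x , y , ws ++ zs , ↭-trans (++⁺ˡ ws p) (↭-shift ws zs) , ↭-trans (++⁺ˡ ws q) (↭-shift ws zs) , x⇝y

  ⇝₁-++ʳ : ∀ ws {xs ys} → xs ⇝₁ ys → xs ++ ws ⇝₁ ys ++ ws
  ⇝₁-++ʳ ws (x , y , zs , p , q , x⇝y) = x , y , zs ++ ws , ++⁺ʳ ws p , ++⁺ʳ ws q , x⇝y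

  All-Terminating-⇝₁ : ∀ {xs ys} → xs ⇝₁ ys → All Terminating xs → All Terminating ys
  All-Terminating-⇝₁ (x , y , zs , p , q , x⇝y) all-xs
    with acc rs ∷ all-zs ← All-resp-↭ Terminating-resp-≈ p all-xs
    = All-resp-↭ Terminating-resp-≈ (↭-sym q) (rs x⇝y ∷ all-zs)

  ∷-↭-∷ : ∀ {x xs y ys} → x ∷ xs ↭ y ∷ ys →
          (x ≈ y × xs ↭ ys) ⊎ ∃ λ zs → xs ↭ y ∷ zs × ys ↭ x ∷ zs
  ∷-↭-∷ {y = y} {ys} p with ↭-split y [] ys p
  ... | [] , qs , x≈y ∷ xs≋qs , qs↭ys = inj₁ (x≈y , ↭-trans (↭-reflexive-≋ xs≋qs) qs↭ys)
  ... | w ∷ ps , qs , x≈w ∷ xs≋ , ws↭ys =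
    inj₂ (ps ++ qs , ↭-trans (↭-reflexive-≋ xs≋) (↭-shift ps qs) ,
          ↭-trans (↭-sym ws↭ys) (prep (≈-sym x≈w) ↭-refl))

  Acc-⇝₁-resp-↭ : ∀ {xs ys} → xs ↭ ys → Acc (flip _⇝₁_) xs → Acc (flip _⇝₁_) ys
  Acc-⇝₁-resp-↭ p (acc rs) = acc λ ys⇝₁zs → rs (⇝₁-resp-↭ p ys⇝₁zs ↭-refl)

  acc-∷ : ∀ {x xs} → Terminating x → Acc (flip _⇝₁_) xs → Acc (flip _⇝₁_) (x ∷ xs)
  acc-∷ {x} {xs} acc-x@(acc below-x) acc-xs@(acc below-xs) = acc reduct
    where
    reduct : ∀ {ys} → x ∷ xs ⇝₁ ys → Acc (flip _⇝₁_) ys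
    reduct (u , v , zs , p , q , u⇝v) with ∷-↭-∷ p
    ... | inj₁ (x≈u , xs↭zs) =
      Acc-⇝₁-resp-↭ (↭-sym (↭-trans q (↭-prep v (↭-sym xs↭zs))))
                    (acc-∷ (below-x (⇝-respˡ (≈-sym x≈u) u⇝v)) acc-xs)
    ... | inj₂ (ws , xs↭ , zs↭) =
      Acc-⇝₁-resp-↭ (↭-sym (↭-trans q (↭-trans (↭-prep v zs↭) (↭-swap v x ↭-refl))))
                    (acc-∷ acc-x (below-xs (u , v , ws , xs↭ , ↭-refl , u⇝v)))

  acc-⇝₁ : ∀ {xs} → All Terminating xs → Acc (flip _⇝₁_) xs
  acc-⇝₁ []           = acc λ (_ , _ , _ , []↭ , _) → ⊥-elim (¬x∷xs↭[] (↭-sym []↭))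
  acc-⇝₁ (t-x ∷ t-xs) = acc-∷ t-x (acc-⇝₁ t-xs)

-- Rewriting modulo AC

infix 4 _≈_ _⇒_

-- CtxClosure with the position recorded in the derivation, so that the steps out
-- of a term with a known head symbol can be inverted by pattern matching.
data Rewrite (R : Rel Term 0ℓ) : Rel Term 0ℓ where
  root : ∀ {t u} → R t u → Rewrite R t u
  I↓   : ∀ {t u} → Rewrite R t u → Rewrite R (I t) (I u)
  E↓   : ∀ {t u} → Rewrite R t u → Rewrite R (E t) (E u)
  s↓   : ∀ {t u} → Rewrite R t u → Rewrite R (s t) (s u)
  C↓₁  : ∀ {t u x} → Rewrite R t u → Rewrite R (C t x) (C u x)
  C↓₂  : ∀ {n t u} → Rewrite R t u → Rewrite R (C n t) (C n u)
  D↓₁  : ∀ {t u x} → Rewrite R t u → Rewrite R (D t x) (D u x)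
  D↓₂  : ∀ {n t u} → Rewrite R t u → Rewrite R (D n t) (D n u)
  A↓₁  : ∀ {v t u x} → Rewrite R t u → Rewrite R (A v t x) (A v u x)
  A↓₂  : ∀ {v n t u} → Rewrite R t u → Rewrite R (A v n t) (A v n u)
  B↓₁  : ∀ {v t u x} → Rewrite R t u → Rewrite R (B v t x) (B v u x)
  B↓₂  : ∀ {v n t u} → Rewrite R t u → Rewrite R (B v n t) (B v n u)
  ∣↓₁  : ∀ {t u y} → Rewrite R t u → Rewrite R (t ∣ y) (u ∣ y)
  ∣↓₂  : ∀ {x t u} → Rewrite R t u → Rewrite R (x ∣ t) (x ∣ u)

Congruent : (Term → Term) → Set₁
Congruent F = ∀ {R : Rel Term 0ℓ} {t u} → Rewrite R t u → Rewrite R (F t) (F u)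

plug : ∀ {R : Rel Term 0ℓ} c {t u} → Rewrite R t u → Rewrite R (c [ t ]) (c [ u ])
plug □          p = p
plug (I□ c)     p = I↓ (plug c p)
plug (E□ c)     p = E↓ (plug c p)
plug (s□ c)     p = s↓ (plug c p)
plug (C₁ c _)   p = C↓₁ (plug c p)
plug (C₂ _ c)   p = C↓₂ (plug c p)
plug (D₁ c _)   p = D↓₁ (plug c p)
plug (D₂ _ c)   p = D↓₂ (plug c p)
plug (A₁ _ c _) p = A↓₁ (plug c p)
plug (A₂ _ _ c) p = A↓₂ (plug c p)
plug (B₁ _ c _) p = B↓₁ (plug c p)
plug (B₂ _ _ c) p = B↓₂ (plug c p)
plug (∣₁ c _)   p = ∣↓₁ (plug c p)
plug (∣₂ _ c)   p = ∣↓₂ (plug c p)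

Rewrite-flip : ∀ {R : Rel Term 0ℓ} {t u} → Rewrite R t u → Rewrite (flip R) u t
Rewrite-flip (root r) = root r
Rewrite-flip (I↓ p)   = I↓ (Rewrite-flip p)
Rewrite-flip (E↓ p)   = E↓ (Rewrite-flip p)
Rewrite-flip (s↓ p)   = s↓ (Rewrite-flip p)
Rewrite-flip (C↓₁ p)  = C↓₁ (Rewrite-flip p)
Rewrite-flip (C↓₂ p)  = C↓₂ (Rewrite-flip p)
Rewrite-flip (D↓₁ p)  = D↓₁ (Rewrite-flip p)
Rewrite-flip (D↓₂ p)  = D↓₂ (Rewrite-flip p)
Rewrite-flip (A↓₁ p)  = A↓₁ (Rewrite-flip p)
Rewrite-flip (A↓₂ p)  = A↓₂ (Rewrite-flip p)
Rewrite-flip (B↓₁ p)  = B↓₁ (Rewrite-flip p)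
Rewrite-flip (B↓₂ p)  = B↓₂ (Rewrite-flip p)
Rewrite-flip (∣↓₁ p)  = ∣↓₁ (Rewrite-flip p)
Rewrite-flip (∣↓₂ p)  = ∣↓₂ (Rewrite-flip p)

_≈_ : Rel Term 0ℓ
_≈_ = EqClosure.EqClosure (Rewrite ACAxiom)

≈-setoid : Setoid 0ℓ 0ℓ
≈-setoid = EqClosure.setoid (Rewrite ACAxiom)

≈-sym : ∀ {t u} → t ≈ u → u ≈ t
≈-sym = EqClosure.symmetric (Rewrite ACAxiom)

≈-cong : ∀ {F} → Congruent F → ∀ {t u} → t ≈ u → F t ≈ F u
≈-cong {F} lift = EqClosure.gmap F lift

=AC⇒≈ : ∀ {t u} → t =AC u → t ≈ u
=AC⇒≈ = EqClosure.map λ { (ctx c ax) → plug c (root ax) }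

data _⇒_ (t u : Term) : Set where
  step : ∀ {t′ u′} → t ≈ t′ → Rewrite (Hlab ∪ Dec) t′ u′ → u′ ≈ u → t ⇒ u

⟶⇒⇒ : ∀ {t u} → t ⟶[ Hlab ∪ Dec /AC] u → t ⇒ u
⟶⇒⇒ (step e (ctx c r) e′) = step (=AC⇒≈ e) (plug c (root r)) (=AC⇒≈ e′)

⇒-respˡ : ∀ {t t′ u} → t′ ≈ t → t′ ⇒ u → t ⇒ u
⇒-respˡ e (step e₁ p e₂) = step (≈-sym e ◅◅ e₁) p e₂

⇒-cong : ∀ {F} → Congruent F → ∀ {t u} → t ⇒ u → F t ⇒ F u
⇒-cong lift (step e₁ p e₂) = step (≈-cong lift e₁) (lift p) (≈-cong lift e₂)

open Permutation ≈-setoid using (_↭_; prep; ↭-refl; ↭-sym; ↭-isEquivalence)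
open Permutationₚ ≈-setoid using (++-assoc; ++-comm; ++-identityʳ; ++⁺ˡ; ++⁺ʳ)
open Subset ≈-setoid using (_⊆_)
open ListReplacement ≈-setoid _⇒_ ⇒-respˡ renaming (Terminating to SN; Terminating-resp-≈ to SN-resp-≈)

-- Weight and aliens

⟦_⟧ : Term → ℕ
⟦ var _ ⟧   = 0
⟦ h ⟧       = 1
⟦ 𝟘 ⟧       = 0
⟦ I t ⟧     = suc (2 * ⟦ t ⟧)
⟦ E t ⟧     = suc ⟦ t ⟧
⟦ s t ⟧     = suc ⟦ t ⟧
⟦ C n x ⟧   = (2 + ⟦ n ⟧) * suc ⟦ x ⟧
⟦ D n x ⟧   = (2 + ⟦ n ⟧) * suc (3 * ⟦ x ⟧)
⟦ A _ _ _ ⟧ = 1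
⟦ B _ _ _ ⟧ = 1
⟦ t ∣ u ⟧   = ⟦ t ⟧ + ⟦ u ⟧

aliens : Term → List Term
aliens (var _)   = []
aliens h         = []
aliens 𝟘         = []
aliens (I t)     = aliens t
aliens (E t)     = aliens t
aliens (s t)     = aliens t
aliens (C n x)   = aliens n ++ aliens x
aliens (D n x)   = aliens n ++ aliens x
aliens (A v n x) = A v n x ∷ []
aliens (B v n x) = B v n x ∷ []
aliens (t ∣ u)   = aliens t ++ aliens u

⟦⟧-AC : ∀ {t u} → Rewrite ACAxiom t u → ⟦ t ⟧ ≡ ⟦ u ⟧
⟦⟧-AC (root (assoc x y z)) = +-assoc ⟦ x ⟧ ⟦ y ⟧ ⟦ z ⟧
⟦⟧-AC (root (comm x y))    = +-comm ⟦ x ⟧ ⟦ y ⟧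
⟦⟧-AC (I↓ p)               = cong (λ w → suc (2 * w)) (⟦⟧-AC p)
⟦⟧-AC (E↓ p)               = cong suc (⟦⟧-AC p)
⟦⟧-AC (s↓ p)               = cong suc (⟦⟧-AC p)
⟦⟧-AC (C↓₁ {x = x} p)      = cong (λ w → (2 + w) * suc ⟦ x ⟧) (⟦⟧-AC p)
⟦⟧-AC (C↓₂ {n = n} p)      = cong (λ w → (2 + ⟦ n ⟧) * suc w) (⟦⟧-AC p)
⟦⟧-AC (D↓₁ {x = x} p)      = cong (λ w → (2 + w) * suc (3 * ⟦ x ⟧)) (⟦⟧-AC p)
⟦⟧-AC (D↓₂ {n = n} p)      = cong (λ w → (2 + ⟦ n ⟧) * suc (3 * w)) (⟦⟧-AC p)
⟦⟧-AC (A↓₁ _)              = refl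
⟦⟧-AC (A↓₂ _)              = refl
⟦⟧-AC (B↓₁ _)              = refl
⟦⟧-AC (B↓₂ _)              = refl
⟦⟧-AC (∣↓₁ {y = y} p)      = cong (_+ ⟦ y ⟧) (⟦⟧-AC p)
⟦⟧-AC (∣↓₂ {x = x} p)      = cong (⟦ x ⟧ +_) (⟦⟧-AC p)

aliens-AC : ∀ {t u} → Rewrite ACAxiom t u → aliens t ↭ aliens u
aliens-AC (root (assoc x y z)) = ++-assoc (aliens x) (aliens y) (aliens z)
aliens-AC (root (comm x y))    = ++-comm (aliens x) (aliens y)
aliens-AC (I↓ p)               = aliens-AC p
aliens-AC (E↓ p)               = aliens-AC p
aliens-AC (s↓ p)               = aliens-AC p
aliens-AC (C↓₁ {x = x} p)      = ++⁺ʳ (aliens x) (aliens-AC p)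
aliens-AC (C↓₂ {n = n} p)      = ++⁺ˡ (aliens n) (aliens-AC p)
aliens-AC (D↓₁ {x = x} p)      = ++⁺ʳ (aliens x) (aliens-AC p)
aliens-AC (D↓₂ {n = n} p)      = ++⁺ˡ (aliens n) (aliens-AC p)
aliens-AC p@(A↓₁ _)            = prep (EqClosure.return p) ↭-refl
aliens-AC p@(A↓₂ _)            = prep (EqClosure.return p) ↭-refl
aliens-AC p@(B↓₁ _)            = prep (EqClosure.return p) ↭-refl
aliens-AC p@(B↓₂ _)            = prep (EqClosure.return p) ↭-refl
aliens-AC (∣↓₁ {y = y} p)      = ++⁺ʳ (aliens y) (aliens-AC p)
aliens-AC (∣↓₂ {x = x} p)      = ++⁺ˡ (aliens x) (aliens-AC p)

⟦⟧-resp-≈ : ∀ {t u} → t ≈ u → ⟦ t ⟧ ≡ ⟦ u ⟧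
⟦⟧-resp-≈ = EqClosure.gfold isEquivalence ⟦_⟧ ⟦⟧-AC

aliens-resp-≈ : ∀ {t u} → t ≈ u → aliens t ↭ aliens u
aliens-resp-≈ = EqClosure.gfold ↭-isEquivalence aliens aliens-AC

data Descent (w w′ : ℕ) (as bs : List Term) : Set where
  lighter    : w′ < w → bs ⊆ as → Descent w w′ as bs
  alien-step : w′ ≡ w → as ⇝₁ bs → Descent w w′ as bs

Descent-map : ∀ {w w′ as bs} (f : ℕ → ℕ) → (∀ {m n} → m < n → f m < f n) →
              Descent w w′ as bs → Descent (f w) (f w′) as bs
Descent-map f f-mono (lighter lt bs⊆as) = lighter (f-mono lt) bs⊆as
Descent-map f f-mono (alien-step eq as⇝bs) = alien-step (cong f eq) as⇝bs

Descent-++ˡ : ∀ {w w′ as bs} ws → Descent w w′ as bs → Descent w w′ (ws ++ as) (ws ++ bs)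
Descent-++ˡ ws (lighter lt bs⊆as) = lighter lt (⊆.++⁺ʳ ≈-setoid ws bs⊆as)
Descent-++ˡ ws (alien-step eq as⇝bs) = alien-step eq (⇝₁-++ˡ ws as⇝bs)

Descent-++ʳ : ∀ {w w′ as bs} ws → Descent w w′ as bs → Descent w w′ (as ++ ws) (bs ++ ws)
Descent-++ʳ ws (lighter lt bs⊆as) = lighter lt (⊆.++⁺ˡ ≈-setoid ws bs⊆as)
Descent-++ʳ ws (alien-step eq as⇝bs) = alien-step eq (⇝₁-++ʳ ws as⇝bs)

<-by-excess : ∀ {m n} k → n ≡ m + suc k → m < n
<-by-excess {m} k refl = m<m+n m z<s

++-⊆-absorb : ∀ (xs ys : List Term) → xs ++ ys ++ xs ⊆ ys ++ xs
++-⊆-absorb xs ys p = [ Any.++⁺ʳ ys , id ]′ (Any.++⁻ xs p)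

alien-rewrite : ∀ {t u} → Rewrite (Hlab ∪ Dec) t u → t ∷ [] ⇝₁ u ∷ []
alien-rewrite p = ⇝₁-singleton (step ε p ε)

-- Each equation below, checked by ring normalisation, writes ⟦ l ⟧ as ⟦ r ⟧ plus a
-- positive excess.
root-descent : ∀ {l r} → (Hlab ∪ Dec) l r → Descent ⟦ l ⟧ ⟦ r ⟧ (aliens l) (aliens r)
root-descent ρ@(inj₁ (r1 _))           = alien-step refl (alien-rewrite (root ρ))
root-descent ρ@(inj₁ (r2 _ _ _))       = alien-step refl (alien-rewrite (root ρ))
root-descent ρ@(inj₁ (r3 _ _ _))       = alien-step refl (alien-rewrite (root ρ))
root-descent ρ@(inj₁ (r14 _ _ _))      = alien-step refl (alien-rewrite (root ρ))
root-descent ρ@(inj₂ (decA _ _ _ _ _)) = alien-step refl (alien-rewrite (root ρ))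
root-descent ρ@(inj₂ (decB _ _ _ _ _)) = alien-step refl (alien-rewrite (root ρ))
root-descent (inj₁ (r4 x)) = lighter (<-by-excess ⟦ x ⟧ (eq ⟦ x ⟧)) (⊆.⊆-refl ≈-setoid)
  where eq : ∀ x → (2 + 0) * suc x ≡ suc x + suc x
        eq = solve-∀
root-descent (inj₁ (r5 n x)) = lighter (<-by-excess 0 (eq ⟦ n ⟧ ⟦ x ⟧)) (++-⊆-absorb (aliens x) (aliens n))
  where eq : ∀ n x → (2 + suc n) * suc x ≡ (x + (2 + n) * suc x) + suc 0
        eq = solve-∀
root-descent (inj₁ (r6 x y)) = lighter (<-by-excess 0 (eq ⟦ x ⟧ ⟦ y ⟧)) (⊆.⊆-refl ≈-setoid)
  where eq : ∀ x y → suc (2 * (suc x + y)) ≡ suc (suc (2 * (x + y))) + suc 0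
        eq = solve-∀
root-descent (inj₁ (r7 x)) = lighter (<-by-excess 0 (eq ⟦ x ⟧)) (⊆.⊆-refl ≈-setoid)
  where eq : ∀ x → suc (2 * suc x) ≡ suc (suc (2 * x)) + suc 0
        eq = solve-∀
root-descent (inj₁ (r8 n x)) = lighter (<-by-excess (2 * ⟦ n ⟧ + 2) (eq ⟦ n ⟧ ⟦ x ⟧)) (⊆.⊆-refl ≈-setoid)
  where eq : ∀ n x → (2 + n) * suc (3 * suc (2 * suc (2 * x)))
                     ≡ suc (2 * ((2 + n) * suc (3 * suc (2 * x)))) + suc (2 * n + 2)
        eq = solve-∀
root-descent (inj₁ (r9 n x y)) =
  lighter (<-by-excess (6 * ⟦ n ⟧ * ⟦ y ⟧ + 2 * ⟦ n ⟧ + 10 * ⟦ y ⟧ + 2) (eq ⟦ n ⟧ ⟦ x ⟧ ⟦ y ⟧))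
          (⊆.⊆-reflexive-↭ ≈-setoid (++-assoc (aliens n) (aliens x) (aliens y)))
  where eq : ∀ n x y → (2 + n) * suc (3 * suc (2 * (suc (2 * x) + y)))
                       ≡ suc (2 * ((2 + n) * suc (3 * suc (2 * x)) + y)) + suc (6 * n * y + 2 * n + 10 * y + 2)
        eq = solve-∀
root-descent (inj₁ (r10 n x y)) =
  lighter (<-by-excess (8 * ⟦ n ⟧ * ⟦ x ⟧ + 6 * ⟦ n ⟧ * ⟦ y ⟧ + 18 * ⟦ n ⟧ + 16 * ⟦ x ⟧ + 10 * ⟦ y ⟧ + 34)
                       (eq ⟦ n ⟧ ⟦ x ⟧ ⟦ y ⟧))
          (⊆.⊆-reflexive-↭ ≈-setoid (++-assoc (aliens n) (aliens x) (aliens y)))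
  where eq : ∀ n x y → (2 + n) * suc (3 * suc (2 * (suc (2 * (1 + x)) + y)))
                       ≡ suc (2 * ((2 + n) * suc (suc (2 * x)) + y))
                         + suc (8 * n * x + 6 * n * y + 18 * n + 16 * x + 10 * y + 34)
        eq = solve-∀
root-descent (inj₁ (r11 n x)) =
  lighter (<-by-excess (8 * ⟦ n ⟧ * ⟦ x ⟧ + 18 * ⟦ n ⟧ + 16 * ⟦ x ⟧ + 34) (eq ⟦ n ⟧ ⟦ x ⟧)) (⊆.⊆-refl ≈-setoid)
  where eq : ∀ n x → (2 + n) * suc (3 * suc (2 * suc (2 * (1 + x))))
                     ≡ suc (2 * ((2 + n) * suc (suc (2 * x)))) + suc (8 * n * x + 18 * n + 16 * x + 34)
        eq = solve-∀
root-descent (inj₁ (r12 n y)) =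
  lighter (<-by-excess (6 * ⟦ n ⟧ * ⟦ y ⟧ + 18 * ⟦ n ⟧ + 10 * ⟦ y ⟧ + 34) (eq ⟦ n ⟧ ⟦ y ⟧))
          (⊆.⊆-reflexive-↭ ≈-setoid (++⁺ʳ (aliens y) (++-identityʳ (aliens n))))
  where eq : ∀ n y → (2 + n) * suc (3 * suc (2 * (suc (2 * 1) + y)))
                     ≡ suc (2 * ((2 + n) * suc 1 + y)) + suc (6 * n * y + 18 * n + 10 * y + 34)
        eq = solve-∀
root-descent (inj₁ (r13 n)) = lighter (<-by-excess (18 * ⟦ n ⟧ + 34) (eq ⟦ n ⟧)) (⊆.⊆-refl ≈-setoid)
  where eq : ∀ n → (2 + n) * suc (3 * suc (2 * suc (2 * 1))) ≡ suc (2 * ((2 + n) * suc 1)) + suc (18 * n + 34)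
        eq = solve-∀

descent : ∀ {t u} → Rewrite (Hlab ∪ Dec) t u → Descent ⟦ t ⟧ ⟦ u ⟧ (aliens t) (aliens u)
descent (root ρ) = root-descent ρ
descent (I↓ p) = Descent-map (λ w → suc (2 * w)) (λ lt → s≤s (*-monoʳ-< 2 lt)) (descent p)
descent (E↓ p) = Descent-map suc s≤s (descent p)
descent (s↓ p) = Descent-map suc s≤s (descent p)
descent (C↓₁ {x = x} p) =
  Descent-map (λ w → (2 + w) * suc ⟦ x ⟧) (λ lt → *-monoˡ-< (suc ⟦ x ⟧) (s≤s (s≤s lt)))
              (Descent-++ʳ (aliens x) (descent p))
descent (C↓₂ {n = n} p) =
  Descent-map (λ w → (2 + ⟦ n ⟧) * suc w) (λ lt → *-monoʳ-< (2 + ⟦ n ⟧) (s≤s lt))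
              (Descent-++ˡ (aliens n) (descent p))
descent (D↓₁ {x = x} p) =
  Descent-map (λ w → (2 + w) * suc (3 * ⟦ x ⟧)) (λ lt → *-monoˡ-< (suc (3 * ⟦ x ⟧)) (s≤s (s≤s lt)))
              (Descent-++ʳ (aliens x) (descent p))
descent (D↓₂ {n = n} p) =
  Descent-map (λ w → (2 + ⟦ n ⟧) * suc (3 * w)) (λ lt → *-monoʳ-< (2 + ⟦ n ⟧) (s≤s (*-monoʳ-< 3 lt)))
              (Descent-++ˡ (aliens n) (descent p))
descent p@(A↓₁ _) = alien-step refl (alien-rewrite p)
descent p@(A↓₂ _) = alien-step refl (alien-rewrite p)
descent p@(B↓₁ _) = alien-step refl (alien-rewrite p)
descent p@(B↓₂ _) = alien-step refl (alien-rewrite p)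
descent (∣↓₁ {y = y} p) = Descent-map (_+ ⟦ y ⟧) (+-monoˡ-< ⟦ y ⟧) (Descent-++ʳ (aliens y) (descent p))
descent (∣↓₂ {x = x} p) = Descent-map (⟦ x ⟧ +_) (+-monoʳ-< ⟦ x ⟧) (Descent-++ˡ (aliens x) (descent p))

Descent-resp-↭ : ∀ {w w′ as as′ bs bs′} → as ↭ as′ → Descent w w′ as′ bs′ → bs′ ↭ bs → Descent w w′ as bs
Descent-resp-↭ p (lighter lt sub) q = lighter lt (⊆.⊆-respˡ-↭ ≈-setoid q (⊆.⊆-respʳ-↭ ≈-setoid (↭-sym p) sub))
Descent-resp-↭ p (alien-step eq st) q = alien-step eq (⇝₁-resp-↭ p st q)

⇒-descent : ∀ {t u} → t ⇒ u → Descent ⟦ t ⟧ ⟦ u ⟧ (aliens t) (aliens u)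
⇒-descent (step t≈t′ p u′≈u) rewrite ⟦⟧-resp-≈ t≈t′ | sym (⟦⟧-resp-≈ u′≈u) =
  Descent-resp-↭ (aliens-resp-≈ t≈t′) (descent p) (aliens-resp-≈ u′≈u)

SN-of-aliens : ∀ {t} → All SN (aliens t) → SN t
SN-of-aliens {t} = by-weight (<-wellFounded ⟦ t ⟧) refl
  where
  by-weight : ∀ {w} → Acc _<_ w → ∀ {t} → ⟦ t ⟧ ≡ w → All SN (aliens t) → SN t
  by-weight {w} (acc smaller) wt sn-aliens = by-aliens wt (acc-⇝₁ sn-aliens) sn-aliens
    where
    by-aliens : ∀ {t} → ⟦ t ⟧ ≡ w → Acc (flip _⇝₁_) (aliens t) → All SN (aliens t) → SN t
    by-aliens {t} wt (acc fewer) sn-aliens = acc reduct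
      where
      reduct : ∀ {u} → t ⇒ u → SN u
      reduct t⇒u with ⇒-descent t⇒u
      ... | lighter lt sub =
        by-weight (smaller (subst (_ <_) wt lt)) refl (⊆.All-resp-⊇ ≈-setoid SN-resp-≈ sub sn-aliens)
      ... | alien-step eq st = by-aliens (trans eq wt) (fewer st) (All-Terminating-⇝₁ st sn-aliens)

SN-sub : ∀ {F} → Congruent F → ∀ {t} → SN (F t) → SN t
SN-sub lift (acc rs) = acc λ t⇒u → SN-sub lift (rs (⇒-cong lift t⇒u))

aliens-SN : ∀ t → SN t → All SN (aliens t)
aliens-SN (var _)   _  = []
aliens-SN h         _  = []
aliens-SN 𝟘         _  = []
aliens-SN (I t)     sn = aliens-SN t (SN-sub I↓ sn)
aliens-SN (E t)     sn = aliens-SN t (SN-sub E↓ sn)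
aliens-SN (s t)     sn = aliens-SN t (SN-sub s↓ sn)
aliens-SN (C n x)   sn = All.++⁺ (aliens-SN n (SN-sub C↓₁ sn)) (aliens-SN x (SN-sub C↓₂ sn))
aliens-SN (D n x)   sn = All.++⁺ (aliens-SN n (SN-sub D↓₁ sn)) (aliens-SN x (SN-sub D↓₂ sn))
aliens-SN (A _ _ _) sn = sn ∷ []
aliens-SN (B _ _ _) sn = sn ∷ []
aliens-SN (t ∣ u)   sn = All.++⁺ (aliens-SN t (SN-sub ∣↓₁ sn)) (aliens-SN u (SN-sub ∣↓₂ sn))

-- Terms headed by a free binary symbol

data NodeStep (R : Rel Term 0ℓ) (F : Term → Term → Term) (n x : Term) : Term → Set where
  at-root  : ∀ {u} → R (F n x) u → NodeStep R F n x u
  in-left  : ∀ {n′} → Rewrite R n n′ → NodeStep R F n x (F n′ x)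
  in-right : ∀ {x′} → Rewrite R x x′ → NodeStep R F n x (F n x′)

record FreeBinary (F : Term → Term → Term) : Set₁ where
  field
    view    : ∀ {R n x u} → Rewrite R (F n x) u → NodeStep R F n x u
    cong₁   : ∀ {x} → Congruent (λ n → F n x)
    cong₂   : ∀ {n} → Congruent (F n)
    not-AC  : ∀ {n x u} → ¬ ACAxiom (F n x) u
    not-AC⁻ : ∀ {n x u} → ¬ ACAxiom u (F n x)

module _ {F} (F-free : FreeBinary F) where
  open FreeBinary F-free

  ≈₁-args : ∀ {n x t} → SymClosure (Rewrite ACAxiom) (F n x) t →
            ∃₂ λ n′ x′ → t ≡ F n′ x′ × n ≈ n′ × x ≈ x′
  ≈₁-args (fwd p) with view p
  ... | at-root ax = ⊥-elim (not-AC ax)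
  ... | in-left q  = _ , _ , refl , fwd q ◅ ε , ε
  ... | in-right q = _ , _ , refl , ε , fwd q ◅ ε
  ≈₁-args (bwd p) with view (Rewrite-flip p)
  ... | at-root ax = ⊥-elim (not-AC⁻ ax)
  ... | in-left q  = _ , _ , refl , bwd (Rewrite-flip q) ◅ ε , ε
  ... | in-right q = _ , _ , refl , ε , bwd (Rewrite-flip q) ◅ ε

  ≈-args : ∀ {n x t} → F n x ≈ t → ∃₂ λ n′ x′ → t ≡ F n′ x′ × n ≈ n′ × x ≈ x′
  ≈-args ε = _ , _ , refl , ε , ε
  ≈-args (p ◅ ps) with ≈₁-args p
  ... | _ , _ , refl , n≈ , x≈ with ≈-args ps
  ...   | n′ , x′ , eq , n≈′ , x≈′ = n′ , x′ , eq , n≈ ◅◅ n≈′ , x≈ ◅◅ x≈′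

  SN-node : (∀ {n x u} → SN n → SN x → (Hlab ∪ Dec) (F n x) u → SN u) →
            ∀ {n x} → SN n → SN x → SN (F n x)
  SN-node root-SN {n} {x} sn@(acc n-reducts) sx@(acc x-reducts) = acc reduct
    where
    reduct : ∀ {u} → F n x ⇒ u → SN u
    reduct (step e p u′≈u) with ≈-args e
    ... | _ , _ , refl , n≈n′ , x≈x′ with view p
    ...   | at-root ρ  = SN-resp-≈ u′≈u (root-SN (SN-resp-≈ n≈n′ sn) (SN-resp-≈ x≈x′ sx) ρ)
    ...   | in-left q  = SN-resp-≈ (≈-cong cong₂ x≈x′ ◅◅ u′≈u) (SN-node root-SN (n-reducts (step n≈n′ q ε)) sx)
    ...   | in-right q = SN-resp-≈ (≈-cong cong₁ n≈n′ ◅◅ u′≈u) (SN-node root-SN sn (x-reducts (step x≈x′ q ε)))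

A-free : ∀ v → FreeBinary (A v)
A-free v = record
  { view    = λ { (root ρ) → at-root ρ ; (A↓₁ p) → in-left p ; (A↓₂ p) → in-right p }
  ; cong₁   = A↓₁
  ; cong₂   = A↓₂
  ; not-AC  = λ ()
  ; not-AC⁻ = λ ()
  }

B-free : ∀ v → FreeBinary (B v)
B-free v = record
  { view    = λ { (root ρ) → at-root ρ ; (B↓₁ p) → in-left p ; (B↓₂ p) → in-right p }
  ; cong₁   = B↓₁
  ; cong₂   = B↓₂
  ; not-AC  = λ ()
  ; not-AC⁻ = λ ()
  }

-- Termination

mutual
  SN-A : ∀ {v} → Acc _<ₒ_ v → ∀ {n x} → SN n → SN x → SN (A v n x)
  SN-A {v} acc-v = SN-node (A-free v) (A-root-SN acc-v)

  -- The arguments of each reduct have no aliens besides those of n and x.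
  A-root-SN : ∀ {v} → Acc _<ₒ_ v → ∀ {n x u} → SN n → SN x → (Hlab ∪ Dec) (A v n x) u → SN u
  A-root-SN (acc below) sn _ (inj₁ (r1 _)) =
    SN-A (below (<-exp <-zero)) (SN-of-aliens (aliens-SN _ sn)) (SN-of-aliens [])
  A-root-SN (acc below) sn sx (inj₁ (r2 v _ _)) =
    SN-A (below (<-exp (<ᶜ-sucᶜ (tm v)))) (SN-of-aliens (aliens-SN _ sn)) (SN-of-aliens (aliens-SN _ sx))
  A-root-SN acc-v sn sx (inj₁ (r3 _ _ _)) =
    SN-B acc-v sn (SN-of-aliens (All.++⁺ (aliens-SN _ sn) (aliens-SN _ sx)))
  A-root-SN (acc below) sn sx (inj₂ (decA _ _ _ _ w<v)) = SN-A (below w<v) sn sx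

  SN-B : ∀ {v} → Acc _<ₒ_ v → ∀ {n x} → SN n → SN x → SN (B v n x)
  SN-B {v} acc-v = SN-node (B-free v) (B-root-SN acc-v)

  B-root-SN : ∀ {v} → Acc _<ₒ_ v → ∀ {n x u} → SN n → SN x → (Hlab ∪ Dec) (B v n x) u → SN u
  B-root-SN (acc below) sn sx (inj₁ (r14 v _ _)) =
    SN-A (below (<ᶜ-sucᶜ (tm v))) (SN-of-aliens (aliens-SN _ sn)) (SN-of-aliens (aliens-SN _ sx))
  B-root-SN (acc below) sn sx (inj₂ (decB _ _ _ _ w<v)) = SN-B (below w<v) sn sx

mutual
  SN-all : ∀ t → SN t
  SN-all t = SN-of-aliens (aliens-SN-all t)

  aliens-SN-all : ∀ t → All SN (aliens t)
  aliens-SN-all (var _)   = []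
  aliens-SN-all h         = []
  aliens-SN-all 𝟘         = []
  aliens-SN-all (I t)     = aliens-SN-all t
  aliens-SN-all (E t)     = aliens-SN-all t
  aliens-SN-all (s t)     = aliens-SN-all t
  aliens-SN-all (C n x)   = All.++⁺ (aliens-SN-all n) (aliens-SN-all x)
  aliens-SN-all (D n x)   = All.++⁺ (aliens-SN-all n) (aliens-SN-all x)
  aliens-SN-all (A v n x) = SN-A (<ₒ-wellFounded v) (SN-all n) (SN-all x) ∷ []
  aliens-SN-all (B v n x) = SN-B (<ₒ-wellFounded v) (SN-all n) (SN-all x) ∷ []
  aliens-SN-all (t ∣ u)   = All.++⁺ (aliens-SN-all t) (aliens-SN-all u)

theorem5p8 : ACTerminating (Hlab ∪ Dec)
theorem5p8 = Subrelation.wellFounded ⟶⇒⇒ SN-all
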